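{- Let $r\ge 1$ and $q\ge 4$ be integers and let $G$ be a minimal graph in $H_v(2_r;q-1)$. Then $F_v(2_r;q-1)\ge F_v(2_r;q)+\alpha(G)-1$.
   Context: All graphs are finite, simple and undirected; $\omega(G)$ is the clique number and $\alpha(G)$ the independence number. $G\overset{v}{\to}(2_r)$ means that for every partition of $V(G)$ into $r$ pairwise disjoint (possibly empty) sets, some part contains two adjacent vertices (equivalently $\chi(G)\ge r+1$). $H_v(2_r;q)$ is the set of graphs $G$ with $G\overset{v}{\to}(2_r)$ and $\omega(G)<q$, and $F_v(2_r;q)=\min\{|V(G)|:G\in H_v(2_r;q)\}$ (exists iff $q\ge 3$). A minimal graph in a nonempty set $\mathcal M$ of graphs is a $G_0\in\mathcal M$ with $|V(G_0)|=\min\{|V(G)|:G\in\mathcal M\}$. -}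

module Defs where

open import Data.Nat using (ℕ; _≤_)
open import Data.Fin using (Fin)
open import Data.Bool using (Bool; true; false)
open import Data.Product using (Σ; _×_)
open import Relation.Binary.PropositionalEquality using (_≡_; _≢_)
open import Relation.Nullary using (¬_)
open import Function.Definitions using (Injective)

record Graph (n : ℕ) : Set where
  field
    adj    : Fin n → Fin n → Bool
    sym    : ∀ i j → adj i j ≡ adj j i
    irrefl : ∀ i → adj i i ≡ false

open Graph public

Edge : ∀ {n} → Graph n → Fin n → Fin n → Set
Edge G i j = adj G i j ≡ true

HasClique : ∀ {n} → Graph n → ℕ → Set
HasClique {n} G k =
  Σ (Fin k → Fin n) λ f → Injective _≡_ _≡_ f × (∀ i j → i ≢ j → Edge G (f i) (f j))

HasIndep : ∀ {n} → Graph n → ℕ → Set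
HasIndep {n} G k =
  Σ (Fin k → Fin n) λ f → Injective _≡_ _≡_ f × (∀ i j → ¬ Edge G (f i) (f j))

CliqueNumberBelow : ∀ {n} → Graph n → ℕ → Set
CliqueNumberBelow G q = ¬ HasClique G q

IsIndependenceNumber : ∀ {n} → Graph n → ℕ → Set
IsIndependenceNumber G a = HasIndep G a × (∀ k → HasIndep G k → k ≤ a)

-- G →v (2_r): every partition of V(G) into r (possibly empty) parts,
-- given as a map Fin n → Fin r, has a part containing an edge.
VArrows : ∀ {n} → Graph n → ℕ → Set
VArrows {n} G r = (c : Fin n → Fin r) → Σ (Fin n) λ i → Σ (Fin n) λ j → Edge G i j × c i ≡ c j

InH : ∀ {n} → ℕ → ℕ → Graph n → Set
InH r q G = VArrows G r × CliqueNumberBelow G q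

IsMinimalInH : ∀ {n} → ℕ → ℕ → Graph n → Set
IsMinimalInH {n} r q G = InH r q G × (∀ m (G' : Graph m) → InH r q G' → n ≤ m)

IsFv : ℕ → ℕ → ℕ → Set
IsFv r q f = Σ (Graph f) (InH r q) × (∀ m (G' : Graph m) → InH r q G' → f ≤ m)

-- Let A be a maximum independent set of G, |A| = α(G). Delete A and add a new vertex
-- adjacent to all remaining vertices. Collapsing A onto the new vertex is a graph
-- homomorphism from G, since A is independent, so the new graph still arrows (2_r);
-- its clique number grows by at most one, so it lies in H_v(2_r; q). Hence
-- F_v(2_r; q) ≤ |V(G)| − α(G) + 1 = F_v(2_r; q − 1) − α(G) + 1.
module Submission where

open import Defs
open import Level using (0ℓ)
open import Data.Nat using (ℕ; suc; _≤_; _+_; _∸_)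
open import Data.Nat.Properties using (+-suc; +-comm; +-monoˡ-≤; ∸-monoˡ-≤; module ≤-Reasoning)
open import Data.Fin using (Fin; zero; suc; punchIn; punchOut; _≟_)
open import Data.Fin.Properties using (any?; injective⇒≤; punchIn-injective; punchInᵢ≢i)
open import Data.List using (List; []; _∷_; filter; length; lookup; allFin)
open import Data.List.Properties using (length-tabulate)
open import Data.List.Relation.Unary.Any using (index)
open import Data.List.Relation.Unary.Any.Properties using (lookup-index)
open import Data.List.Membership.Propositional.Properties using (∈-filter⁺; ∈-allFin)
open import Data.Bool using (Bool; true; false)
open import Data.Product using (Σ; ∃; _×_; _,_)
open import Data.Empty using (⊥-elim)
open import Function using (_∘_)
open import Function.Definitions using (Injective)
open import Relation.Nullary using (¬_; yes; no)
open import Relation.Unary using (Pred; Decidable)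
open import Relation.Unary.Properties using (∁?)
open import Relation.Binary.PropositionalEquality
  using (_≡_; _≢_; refl; trans; cong; subst; subst₂; module ≡-Reasoning)
  renaming (sym to ≡-sym)

Homomorphism : ∀ {m n} → Graph m → Graph n → (Fin m → Fin n) → Set
Homomorphism G H h = ∀ u v → Edge G u v → Edge H (h u) (h v)

VArrows-homomorphism : ∀ {m n r} {G : Graph m} {H : Graph n} {h : Fin m → Fin n} →
  Homomorphism G H h → VArrows G r → VArrows H r
VArrows-homomorphism {h = h} hom G→r c with G→r (c ∘ h)
... | u , v , uv , same-colour = h u , h v , hom u v uv , same-colour

edge⇒≢ : ∀ {n} (G : Graph n) {u v : Fin n} → Edge G u v → u ≢ v
edge⇒≢ G {u} uu refl with () ← trans (≡-sym uu) (irrefl G u)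

pairwise-adjacent⇒HasClique : ∀ {k n} (G : Graph n) (g : Fin k → Fin n) →
  (∀ i j → i ≢ j → Edge G (g i) (g j)) → HasClique G k
pairwise-adjacent⇒HasClique G g adjacent = g , injective , adjacent
  where
  injective : Injective _≡_ _≡_ g
  injective {i} {j} gi≡gj with i ≟ j
  ... | yes i≡j = i≡j
  ... | no i≢j = ⊥-elim (edge⇒≢ G (adjacent i j i≢j) gi≡gj)

HasClique-homomorphism : ∀ {m n k} {G : Graph m} {H : Graph n} {h : Fin m → Fin n} →
  Homomorphism G H h → HasClique G k → HasClique H k
HasClique-homomorphism {H = H} {h} hom (g , _ , adjacent) =
  pairwise-adjacent⇒HasClique H (h ∘ g) (λ i j i≢j → hom (g i) (g j) (adjacent i j i≢j))

induced : ∀ {n} → Graph n → (vs : List (Fin n)) → Graph (length vs)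
induced G vs = record
  { adj    = λ i j → adj G (lookup vs i) (lookup vs j)
  ; sym    = λ i j → sym G (lookup vs i) (lookup vs j)
  ; irrefl = λ i → irrefl G (lookup vs i)
  }

lookup-homomorphism : ∀ {n} (G : Graph n) (vs : List (Fin n)) →
  Homomorphism (induced G vs) G (lookup vs)
lookup-homomorphism G vs u v uv = uv

cone : ∀ {k} → Graph k → Graph (suc k)
cone {k} H = record { adj = adj′ ; sym = sym′ ; irrefl = irrefl′ }
  where
  adj′ : Fin (suc k) → Fin (suc k) → Bool
  adj′ zero    zero    = false
  adj′ zero    (suc _) = true
  adj′ (suc _) zero    = true
  adj′ (suc u) (suc v) = adj H u v

  sym′ : ∀ u v → adj′ u v ≡ adj′ v u
  sym′ zero    zero    = refl
  sym′ zero    (suc _) = refl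
  sym′ (suc _) zero    = refl
  sym′ (suc u) (suc v) = sym H u v

  irrefl′ : ∀ u → adj′ u u ≡ false
  irrefl′ zero    = refl
  irrefl′ (suc u) = irrefl H u

cone-edge-punchOut : ∀ {k} (H : Graph k) {u v : Fin (suc k)} (0≢u : zero ≢ u) (0≢v : zero ≢ v) →
  Edge (cone H) u v → Edge H (punchOut 0≢u) (punchOut 0≢v)
cone-edge-punchOut H {zero}           0≢u _   _  = ⊥-elim (0≢u refl)
cone-edge-punchOut H {suc _} {zero}  _   0≢v _  = ⊥-elim (0≢v refl)
cone-edge-punchOut H {suc _} {suc _} _   _   uv = uv

punchIn-avoiding : ∀ {k n} {h : Fin (suc k) → Fin n} → Injective _≡_ _≡_ h →
  ∀ y → ∃ λ t → ∀ i → h (punchIn t i) ≢ y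
punchIn-avoiding {h = h} h-inj y with any? (λ s → h s ≟ y)
... | yes (s , hs≡y) = s , λ i hi≡y → punchInᵢ≢i s i (h-inj (trans hi≡y (≡-sym hs≡y)))
... | no y∉image     = zero , λ i hi≡y → y∉image (_ , hi≡y)

cone-HasClique : ∀ {k q} (H : Graph k) → HasClique (cone H) (suc q) → HasClique H q
cone-HasClique {k} {q} H (h , h-inj , adjacent) with punchIn-avoiding h-inj zero
... | t , avoids = pairwise-adjacent⇒HasClique H g g-adjacent
  where
  g : Fin q → Fin k
  g i = punchOut (avoids i ∘ ≡-sym)
  g-adjacent : ∀ i j → i ≢ j → Edge H (g i) (g j)
  g-adjacent i j i≢j = cone-edge-punchOut H (avoids i ∘ ≡-sym) (avoids j ∘ ≡-sym)
    (adjacent (punchIn t i) (punchIn t j) (i≢j ∘ punchIn-injective t i j))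

cone-induced-CliqueNumberBelow : ∀ {n q} (G : Graph n) (vs : List (Fin n)) →
  CliqueNumberBelow G q → CliqueNumberBelow (cone (induced G vs)) (suc q)
cone-induced-CliqueNumberBelow G vs ω<q clique =
  ω<q (HasClique-homomorphism {G = induced G vs} {H = G} (lookup-homomorphism G vs)
        (cone-HasClique (induced G vs) clique))

module _ {A : Set} {P : Pred A 0ℓ} (P? : Decidable P) where

  length-filter+length-filter-∁ : ∀ xs →
    length (filter P? xs) + length (filter (∁? P?) xs) ≡ length xs
  length-filter+length-filter-∁ []       = refl
  length-filter+length-filter-∁ (x ∷ xs) with P? x
  ... | yes _ = cong suc (length-filter+length-filter-∁ xs)
  ... | no  _ = trans (+-suc _ _) (cong suc (length-filter+length-filter-∁ xs))

module _ {n : ℕ} {P : Pred (Fin n) 0ℓ} (P? : Decidable P) where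

  inside outside : List (Fin n)
  inside  = filter P? (allFin n)
  outside = filter (∁? P?) (allFin n)

  length-inside+length-outside : length inside + length outside ≡ n
  length-inside+length-outside =
    trans (length-filter+length-filter-∁ P? (allFin n)) (length-tabulate (λ i → i))

  injective⇒≤-length-inside : ∀ {a} {f : Fin a → Fin n} → Injective _≡_ _≡_ f →
    (∀ s → P (f s)) → a ≤ length inside
  injective⇒≤-length-inside {a} {f} f-inj Pf = injective⇒≤ {f = position} position-inj
    where
    position : Fin a → Fin (length inside)
    position s = index (∈-filter⁺ P? (∈-allFin (f s)) (Pf s))
    position-inj : Injective _≡_ _≡_ position
    position-inj {s} {t} eq = f-inj (begin
      f s                      ≡⟨ lookup-index (∈-filter⁺ P? (∈-allFin (f s)) (Pf s)) ⟩
      lookup inside (position s) ≡⟨ cong (lookup inside) eq ⟩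
      lookup inside (position t) ≡⟨ lookup-index (∈-filter⁺ P? (∈-allFin (f t)) (Pf t)) ⟨
      f t                      ∎)
      where open ≡-Reasoning

  module _ (G : Graph n) where

    collapse : Fin n → Fin (suc (length outside))
    collapse v with P? v
    ... | yes _  = zero
    ... | no ¬Pv = suc (index (∈-filter⁺ (∁? P?) (∈-allFin v) ¬Pv))

    collapse-homomorphism : (∀ {u v} → P u → P v → ¬ Edge G u v) →
      Homomorphism G (cone (induced G outside)) collapse
    collapse-homomorphism independent u v uv with P? u | P? v
    ... | yes Pu  | yes Pv  = ⊥-elim (independent Pu Pv uv)
    ... | yes _   | no _    = refl
    ... | no _    | yes _   = refl
    ... | no ¬Pu  | no ¬Pv  = subst₂ (Edge G)
      (lookup-index (∈-filter⁺ (∁? P?) (∈-allFin u) ¬Pu))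
      (lookup-index (∈-filter⁺ (∁? P?) (∈-allFin v) ¬Pv)) uv

InImage : ∀ {a n} → (Fin a → Fin n) → Pred (Fin n) 0ℓ
InImage f v = ∃ λ s → f s ≡ v

remove-independent-set-add-apex : ∀ {n r q a} (G : Graph n) → InH r q G → HasIndep G a →
  Σ ℕ λ k → Σ (Graph (suc k)) (InH r (suc q)) × a + k ≤ n
remove-independent-set-add-apex {n} {r} {q} {a} G (G→r , ω<q) (f , f-inj , f-independent) =
  length (outside image?) , (H , H-arrows , H-clique) , a+k≤n
  where
  image? : Decidable (InImage f)
  image? v = any? (λ s → f s ≟ v)
  H : Graph (suc (length (outside image?)))
  H = cone (induced G (outside image?))
  independent : ∀ {u v} → InImage f u → InImage f v → ¬ Edge G u v
  independent (s , refl) (t , refl) = f-independent s t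
  H-arrows : VArrows H r
  H-arrows = VArrows-homomorphism {G = G} {H = H} {h = collapse image? G}
    (collapse-homomorphism image? G independent) G→r
  H-clique : CliqueNumberBelow H (suc q)
  H-clique = cone-induced-CliqueNumberBelow G (outside image?) ω<q
  a+k≤n : a + length (outside image?) ≤ n
  a+k≤n = subst (a + length (outside image?) ≤_) (length-inside+length-outside image?)
    (+-monoˡ-≤ _ (injective⇒≤-length-inside image? f-inj (λ s → s , refl)))

-- The inequality holds for all r and all q ≥ 1; 4 ≤ q only serves to rule out q = 0.
lemma2p1 : ∀ (r q : ℕ) → 1 ≤ r → 4 ≤ q →
    ∀ (n : ℕ) (G : Graph n) → IsMinimalInH r (q ∸ 1) G →
    ∀ (Fq1 Fq a : ℕ) → IsFv r (q ∸ 1) Fq1 → IsFv r q Fq → IsIndependenceNumber G a →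
    Fq + a ∸ 1 ≤ Fq1
lemma2p1 r (suc q) _ _ n G (G∈H , G-minimal) Fq1 Fq a ((G₁ , G₁∈H) , _) (_ , Fq-least) (α , _)
  with remove-independent-set-add-apex G G∈H α
... | k , (H , H∈H) , a+k≤n = begin
  Fq + a ∸ 1      ≤⟨ ∸-monoˡ-≤ 1 (+-monoˡ-≤ a (Fq-least (suc k) H H∈H)) ⟩
  k + a           ≡⟨ +-comm k a ⟩
  a + k           ≤⟨ a+k≤n ⟩
  n               ≤⟨ G-minimal Fq1 G₁ G₁∈H ⟩
  Fq1             ∎
  where open ≤-Reasoning
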